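{- For every $k\ge 2$ there is $n_0$ such that the following holds for every $k$-graph $H=(V,E)$ on $n\ge n_0$ vertices with $\delta_1(H) \geq (1-\varepsilon)\binom{n-1}{k-1}$, where $\varepsilon = \frac{1}{22(1280k^3)^{k-1}}$ and $\rho = (22\varepsilon)^{1/(k-1)}$. For every good path $P$ in $H$ and every set $F \subset V$ of size at most $k\rho n$, there exists a good path $P'$ that contains $P$ and covers all vertices except those from $F$ and at most $k\rho n$ further vertices.
   Context: $\delta_1(H)$ is the minimum vertex degree of $H$; $\deg(x_1,\ldots,x_i)$ is the number of edges containing $\{x_1,\ldots,x_i\}$. A $(k-1)$-tuple $(x_1,\ldots,x_{k-1})$ is good if its entries are pairwise distinct and $\deg(x_1,\ldots,x_i) \geq (1-\rho^{k-i})\binom{n-i}{k-i}$ for all $i\in\{1,\ldots,k-1\}$. A path in $H$ is given by an ordering $(w_1,\ldots,w_t)$ of distinct vertices, $t\ge k$, with $\{w_j,\ldots,w_{j+k-1}\}\in E$ for all $1\le j\le t-k+1$ (a tight path). Its ends are $(w_1,\ldots,w_{k-1})$ and $(w_t,\ldots,w_{t-k+2})$, and the path is good if both ends are good. -}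

module Defs where

open import Data.Bool using (Bool; true; false; T; _∧_)
open import Data.Nat using (ℕ; zero; suc; _+_; _*_; _∸_; _^_; _≤_; _≥_)
open import Data.Nat.Combinatorics using (_C_)
open import Data.Fin using (Fin)
open import Data.Fin.Subset using (Subset; ⁅_⁆; _∪_; ∁; ∣_∣; ⊥)
open import Data.Fin.Subset.Properties using (_⊆?_)
open import Data.Vec using (_∷_; [])
open import Data.List using (List; []; _∷_; length; filterᵇ; map; _++_; take; drop; reverse; foldr)
open import Data.List.Relation.Unary.Unique.Propositional using (Unique)
open import Data.Product using (_×_; ∃₂)
open import Data.Sum using (_⊎_)
open import Relation.Nullary using (does)
open import Relation.Binary.PropositionalEquality using (_≡_)

allSubsets : (n : ℕ) → List (Subset n)
allSubsets zero = [] ∷ []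
allSubsets (suc n) = map (true ∷_) (allSubsets n) ++ map (false ∷_) (allSubsets n)

record KGraph (k n : ℕ) : Set where
  field
    isEdge  : Subset n → Bool
    uniform : (e : Subset n) → T (isEdge e) → ∣ e ∣ ≡ k
open KGraph public

toSet : {n : ℕ} → List (Fin n) → Subset n
toSet = foldr (λ x S → ⁅ x ⁆ ∪ S) ⊥

deg : {k n : ℕ} → KGraph k n → Subset n → ℕ
deg {n = n} H S = length (filterᵇ (λ e → isEdge H e ∧ does (S ⊆? e)) (allSubsets n))

-- Constants.  M = 1280 k^3.  Then ε = 1 / (22 M^(k-1)) and
-- ρ = (22 ε)^(1/(k-1)) = 1 / M  (exactly, a rational number).
M : ℕ → ℕ
M k = 1280 * (k ^ 3)

-- (x_1,...,x_{k-1}) is good:  pairwise distinct and for all 1 ≤ i ≤ k-1,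
--   deg(x_1..x_i) ≥ (1 - ρ^(k-i)) C(n-i, k-i),
-- i.e. (multiplying by M^(k-i))  deg * M^(k-i) ≥ (M^(k-i) - 1) * C(n-i,k-i)
Good : {k n : ℕ} → KGraph k n → List (Fin n) → Set
Good {k} {n} H xs =
  length xs ≡ k ∸ 1 × Unique xs ×
  ((i : ℕ) → 1 ≤ i → i ≤ k ∸ 1 →
     deg H (toSet (take i xs)) * (M k ^ (k ∸ i))
       ≥ (M k ^ (k ∸ i) ∸ 1) * ((n ∸ i) C (k ∸ i)))

IsPath : {k n : ℕ} → KGraph k n → List (Fin n) → Set
IsPath {k} H w =
  Unique w × k ≤ length w ×
  ((j : ℕ) → j + k ≤ length w → T (isEdge H (toSet (take k (drop j w)))))

GoodPath : {k n : ℕ} → KGraph k n → List (Fin n) → Set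
GoodPath {k} H w =
  IsPath H w × Good H (take (k ∸ 1) w) × Good H (take (k ∸ 1) (reverse w))

ContainsPath : {n : ℕ} → List (Fin n) → List (Fin n) → Set
ContainsPath P' P =
  (∃₂ λ a b → P' ≡ a ++ P ++ b) ⊎ (∃₂ λ a b → reverse P' ≡ a ++ P ++ b)

-- Extend P one vertex at a time in front of its end (x₁, …, x_{k-1}).  Let missing(S)
-- be the number of non-edges among the k-sets containing S; with X = 1/ρ, goodness of
-- the end says missing({x₁, …, x_j}) ≤ C(n-j, k-j) / X^(k-j).  Double counting gives
-- Σ_{v ∉ S_j} missing(S_j ∪ {v}) = (k - j) missing(S_j), so at most n / X vertices v
-- make S_j ∪ {v} violate the bound of level j + 1.  Hence, as long as more than k n / X
-- vertices outside P ∪ F are uncovered, one of them avoids all k - 1 levels.  For such a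
-- v the tuple (v, x₁, …, x_{k-2}) is good (level 1 comes from the minimum degree), and
-- at level k the bound forces missing({v, x₁, …, x_{k-1}}) = 0, i.e. it is an edge.
-- The other end of the path is untouched.
module Submission where

open import Data.Bool using (Bool; true; false; T; not; _∧_; _∨_; if_then_else_)
open import Data.Bool.Properties using (T-∧; T-≡; T-not-≡; ¬-not)
open import Data.Fin using (Fin; zero; suc)
open import Data.Fin.Subset using (Subset; ⁅_⁆; _∪_; ∁; ∣_∣; ⊥; _∈_; _∉_)
open import Data.Fin.Subset.Properties
  using (_⊆?_; ∪-identityˡ; ∪-identityʳ; ∣p∣≤n; ∣⊥∣≡0; ∉⊥; x∈⁅x⁆; x∈⁅y⁆⇒x≡y; x∈p∪q⁺; x∈p∪q⁻; x∈∁p⇒x∉p)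
open import Data.List as List using (List; []; _∷_; length; filterᵇ; take; drop; reverse; _++_)
open import Data.List.Properties
  using (map-++; map-∘; map-cong; length-take; take-take; unfold-reverse; length-reverse; ++-assoc; ++-identityʳ)
open import Data.List.Relation.Unary.All using (All; []; _∷_)
import Data.List.Relation.Unary.All.Properties as All
open import Data.List.Relation.Unary.AllPairs using ([]; _∷_)
open import Data.List.Relation.Unary.Unique.Propositional using (Unique)
import Data.List.Relation.Unary.Unique.Propositional.Properties as Unique
open import Data.Nat using (ℕ; zero; suc; _+_; _*_; _∸_; _^_; _≤_; _<_; _≥_; z≤n; s≤s; s≤s⁻¹; _≡ᵇ_; _≤ᵇ_; >-nonZero)
open import Data.Nat.Combinatorics using (_C_; nC1≡n; nCk+nC[k+1]≡[n+1]C[k+1])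
open import Data.Nat.ListAction using () renaming (sum to sumᴸ)
open import Data.Nat.ListAction.Properties using (sum-++)
open import Data.Nat.Properties
open import Data.Nat.Tactic.RingSolver using (solve-∀)
open import Data.Product using (Σ; ∃; _×_; _,_; proj₁; proj₂)
open import Data.Sum using (inj₁; inj₂)
open import Data.Vec using ([]; _∷_; lookup; here; there)
open import Data.Vec.Properties using (lookup⇒[]=)
open import Function using (_∘_)
open import Function.Bundles using (Equivalence; _⇔_; mk⇔)
open import Relation.Binary.PropositionalEquality
open import Relation.Nullary using (¬_; does; yes; no; contradiction)
open import Relation.Nullary.Decidable using (T?; decidable-stable)

open import Algebra.Properties.Semiring.Sum +-*-semiring
  using (sum; sum-syntax; sum-cong-≗; ∑-distrib-+; *-distribʳ-sum)
open import Algebra.Properties.CommutativeSemigroup +-commutativeSemigroup using (interchange; x∙yz≈y∙xz)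
open import Algebra.Properties.CommutativeSemigroup *-commutativeSemigroup using ()
  renaming (xy∙z≈xz∙y to xy*z≡xz*y)

open import Defs

-- Counting over Fin n

⟦_⟧ : Bool → ℕ
⟦ true  ⟧ = 1
⟦ false ⟧ = 0

¬T⇒⟦⟧≡0 : ∀ {b} → ¬ T b → ⟦ b ⟧ ≡ 0
¬T⇒⟦⟧≡0 {true}  ¬t = contradiction _ ¬t
¬T⇒⟦⟧≡0 {false} _  = refl

⟦⟧≡0⇒¬T : ∀ {b} → ⟦ b ⟧ ≡ 0 → ¬ T b
⟦⟧≡0⇒¬T {false} _ ()

⟦not∧≤ᵇ⟧*≤ : ∀ b x y → ⟦ not b ∧ (x ≤ᵇ y) ⟧ * x ≤ (if b then 0 else y)
⟦not∧≤ᵇ⟧*≤ true  x y = z≤n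
⟦not∧≤ᵇ⟧*≤ false x y with x ≤ᵇ y in x≤y
... | true  = subst (_≤ y) (sym (+-identityʳ x)) (≤ᵇ⇒≤ x y (subst T (sym x≤y) _))
... | false = z≤n

count : ∀ {n} → (Fin n → Bool) → ℕ
count {n} q = ∑[ v < n ] ⟦ q v ⟧

∑-mono-≤ : ∀ {n} {f g : Fin n → ℕ} → (∀ v → f v ≤ g v) → sum f ≤ sum g
∑-mono-≤ {zero}  _   = z≤n
∑-mono-≤ {suc n} f≤g = +-mono-≤ (f≤g zero) (∑-mono-≤ (f≤g ∘ suc))

count-witness : ∀ {n} (q : Fin n → Bool) → 0 < count q → ∃ λ v → T (q v)
count-witness {suc n} q pos with q zero in eq
... | true  = zero , subst T (sym eq) _
... | false = let v , qv = count-witness (q ∘ suc) pos in suc v , qv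

count≤count-∧-not+count : ∀ {n} (q b : Fin n → Bool) →
                          count q ≤ count (λ v → q v ∧ not (b v)) + count b
count≤count-∧-not+count {n} q b = begin
  count q                                     ≤⟨ ∑-mono-≤ (λ v → split (q v) (b v)) ⟩
  ∑[ v < n ] (⟦ q v ∧ not (b v) ⟧ + ⟦ b v ⟧)  ≡⟨ ∑-distrib-+ (λ v → ⟦ q v ∧ not (b v) ⟧) (⟦_⟧ ∘ b) ⟩
  count (λ v → q v ∧ not (b v)) + count b     ∎
  where
  open ≤-Reasoning
  split : ∀ x y → ⟦ x ⟧ ≤ ⟦ x ∧ not y ⟧ + ⟦ y ⟧
  split true  true  = s≤s z≤n
  split true  false = s≤s z≤n
  split false _     = z≤n

∣p∣≡count : ∀ {n} (p : Subset n) → ∣ p ∣ ≡ count (lookup p)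
∣p∣≡count []          = refl
∣p∣≡count (true  ∷ p) = cong suc (∣p∣≡count p)
∣p∣≡count (false ∷ p) = ∣p∣≡count p

sieve : ∀ {n} (X N m : ℕ) (u : Fin n → Bool) (bad : ℕ → Fin n → Bool) →
        (∀ j → 1 ≤ j → j ≤ m → count (bad j) * X ≤ N) → m * N < count u * X →
        ∃ λ v → T (u v) × (∀ j → 1 ≤ j → j ≤ m → bad j v ≡ false)
sieve X N zero u bad _ big =
  let v , uv = count-witness u (*-cancelʳ-< X 0 (count u) big)
  in v , uv , λ j 1≤j j≤0 → contradiction (≤-trans 1≤j j≤0) λ ()
sieve X N (suc m) u bad few big =
  widen (sieve X N m u′ bad (λ j 1≤j j≤m → few j 1≤j (m≤n⇒m≤1+n j≤m)) big′)
  where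
  u′ : Fin _ → Bool
  u′ v = u v ∧ not (bad (suc m) v)

  big′ : m * N < count u′ * X
  big′ = +-cancelˡ-< N (m * N) (count u′ * X) (begin-strict
    N + m * N                              <⟨ big ⟩
    count u * X                            ≤⟨ *-monoˡ-≤ X (count≤count-∧-not+count u (bad (suc m))) ⟩
    (count u′ + count (bad (suc m))) * X   ≡⟨ *-distribʳ-+ X (count u′) _ ⟩
    count u′ * X + count (bad (suc m)) * X ≤⟨ +-monoʳ-≤ (count u′ * X) (few (suc m) (s≤s z≤n) ≤-refl) ⟩
    count u′ * X + N                       ≡⟨ +-comm (count u′ * X) N ⟩
    N + count u′ * X                       ∎)
    where open ≤-Reasoning

  widen : (∃ λ v → T (u′ v) × (∀ j → 1 ≤ j → j ≤ m → bad j v ≡ false)) →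
           ∃ λ v → T (u v) × (∀ j → 1 ≤ j → j ≤ suc m → bad j v ≡ false)
  widen (v , u′v , avoids) = v , proj₁ u′v-split , avoids′
    where
    u′v-split : T (u v) × T (not (bad (suc m) v))
    u′v-split = Equivalence.to T-∧ u′v
    avoids′ : ∀ j → 1 ≤ j → j ≤ suc m → bad j v ≡ false
    avoids′ j 1≤j j≤1+m with m≤n⇒m<n∨m≡n j≤1+m
    ... | inj₁ j<1+m = avoids j 1≤j (s≤s⁻¹ j<1+m)
    ... | inj₂ refl  = Equivalence.to T-not-≡ (proj₂ u′v-split)

C-pos : ∀ {n k} → k ≤ n → 0 < n C k
C-pos {k = zero}        _         = s≤s z≤n
C-pos {suc n} {suc k} (s≤s k≤n) =
  ≤-trans (C-pos k≤n) (≤-trans (m≤m+n (n C k) _) (≤-reflexive (nCk+nC[k+1]≡[n+1]C[k+1] n k)))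

C-absorb : ∀ n k → suc k * (suc n C suc k) ≡ suc n * (n C k)
C-absorb zero    zero    = refl
C-absorb zero    (suc k) = *-zeroʳ (2 + k)
C-absorb (suc n) zero    = trans (+-identityʳ _) (trans (nC1≡n (2 + n)) (cong suc (sym (*-identityʳ _))))
C-absorb (suc n) (suc k) = begin
  (2 + k) * ((2 + n) C (2 + k))                            ≡⟨ cong ((2 + k) *_) (nCk+nC[k+1]≡[n+1]C[k+1] (suc n) (suc k)) ⟨
  (2 + k) * (x + y)                                      ≡⟨ *-distribˡ-+ (2 + k) x y ⟩
  (x + (1 + k) * x) + (2 + k) * y                        ≡⟨ cong₂ (λ s t → (x + s) + t) (C-absorb n k) (C-absorb n (suc k)) ⟩
  (x + (1 + n) * (n C k)) + (1 + n) * (n C suc k)        ≡⟨ +-assoc x _ _ ⟩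
  x + ((1 + n) * (n C k) + (1 + n) * (n C suc k))        ≡⟨ cong (x +_) (*-distribˡ-+ (1 + n) (n C k) (n C suc k)) ⟨
  x + (1 + n) * (n C k + n C suc k)                      ≡⟨ cong (λ t → x + (1 + n) * t) (nCk+nC[k+1]≡[n+1]C[k+1] n k) ⟩
  x + (1 + n) * x                                        ∎
  where
  open ≡-Reasoning
  x y : ℕ
  x = suc n C suc k
  y = suc n C suc (suc k)

-- Sums over supersets

-- ∑⊇ f S = Σ_{e ⊇ S} f e
∑⊇ : ∀ {n} → (Subset n → ℕ) → Subset n → ℕ
∑⊇ {zero}  f []          = f []
∑⊇ {suc n} f (true  ∷ S) = ∑⊇ (f ∘ (true ∷_)) S
∑⊇ {suc n} f (false ∷ S) = ∑⊇ (f ∘ (true ∷_)) S + ∑⊇ (f ∘ (false ∷_)) S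

∑⊇-cong : ∀ {n} {f g : Subset n → ℕ} → (∀ e → f e ≡ g e) → ∀ S → ∑⊇ f S ≡ ∑⊇ g S
∑⊇-cong {zero}  f≗g []          = f≗g []
∑⊇-cong {suc n} f≗g (true  ∷ S) = ∑⊇-cong (f≗g ∘ (true ∷_)) S
∑⊇-cong {suc n} f≗g (false ∷ S) = cong₂ _+_ (∑⊇-cong (f≗g ∘ (true ∷_)) S) (∑⊇-cong (f≗g ∘ (false ∷_)) S)

∑⊇-distrib-+ : ∀ {n} (f g : Subset n → ℕ) S → ∑⊇ (λ e → f e + g e) S ≡ ∑⊇ f S + ∑⊇ g S
∑⊇-distrib-+ {zero}  f g []          = refl
∑⊇-distrib-+ {suc n} f g (true  ∷ S) = ∑⊇-distrib-+ (f ∘ (true ∷_)) (g ∘ (true ∷_)) S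
∑⊇-distrib-+ {suc n} f g (false ∷ S) = begin
  ∑⊇ (λ e → f₁ e + g₁ e) S + ∑⊇ (λ e → f₀ e + g₀ e) S ≡⟨ cong₂ _+_ (∑⊇-distrib-+ f₁ g₁ S) (∑⊇-distrib-+ f₀ g₀ S) ⟩
  (∑⊇ f₁ S + ∑⊇ g₁ S) + (∑⊇ f₀ S + ∑⊇ g₀ S)            ≡⟨ interchange (∑⊇ f₁ S) _ _ _ ⟩
  (∑⊇ f₁ S + ∑⊇ f₀ S) + (∑⊇ g₁ S + ∑⊇ g₀ S)            ∎
  where
  open ≡-Reasoning
  f₁ f₀ g₁ g₀ : Subset n → ℕ
  f₁ = f ∘ (true ∷_)
  f₀ = f ∘ (false ∷_)
  g₁ = g ∘ (true ∷_)
  g₀ = g ∘ (false ∷_)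

∑⊇-*ˡ : ∀ {n} c (f : Subset n → ℕ) S → ∑⊇ (λ e → c * f e) S ≡ c * ∑⊇ f S
∑⊇-*ˡ {zero}  c f []          = refl
∑⊇-*ˡ {suc n} c f (true  ∷ S) = ∑⊇-*ˡ c (f ∘ (true ∷_)) S
∑⊇-*ˡ {suc n} c f (false ∷ S) =
  trans (cong₂ _+_ (∑⊇-*ˡ c (f ∘ (true ∷_)) S) (∑⊇-*ˡ c (f ∘ (false ∷_)) S))
        (sym (*-distribˡ-+ c _ _))

∑⊇-vanishing : ∀ {n} (f : Subset n → ℕ) S → (∀ e → ∣ S ∣ ≤ ∣ e ∣ → f e ≡ 0) → ∑⊇ f S ≡ 0
∑⊇-vanishing {zero}  f []          f≡0 = f≡0 [] z≤n
∑⊇-vanishing {suc n} f (true  ∷ S) f≡0 = ∑⊇-vanishing _ S (λ e → f≡0 (true ∷ e) ∘ s≤s)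
∑⊇-vanishing {suc n} f (false ∷ S) f≡0 =
  cong₂ _+_ (∑⊇-vanishing _ S (λ e → f≡0 (true ∷ e) ∘ m≤n⇒m≤1+n))
            (∑⊇-vanishing _ S (f≡0 ∘ (false ∷_)))

∑⊇-maximal : ∀ {n} (f : Subset n → ℕ) S → (∀ e → ∣ S ∣ < ∣ e ∣ → f e ≡ 0) → ∑⊇ f S ≡ f S
∑⊇-maximal {zero}  f []          f≡0 = refl
∑⊇-maximal {suc n} f (true  ∷ S) f≡0 = ∑⊇-maximal _ S (λ e → f≡0 (true ∷ e) ∘ s≤s)
∑⊇-maximal {suc n} f (false ∷ S) f≡0 =
  cong₂ _+_ (∑⊇-vanishing _ S (λ e → f≡0 (true ∷ e) ∘ s≤s))
            (∑⊇-maximal _ S (f≡0 ∘ (false ∷_)))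

∑⊇-size : ∀ {n} (S : Subset n) a b → n ≡ ∣ S ∣ + a →
          ∑⊇ (λ e → ⟦ ∣ e ∣ ≡ᵇ ∣ S ∣ + b ⟧) S ≡ a C b
∑⊇-size {zero}  []          zero zero    _ = refl
∑⊇-size {zero}  []          zero (suc b) _ = refl
∑⊇-size {suc n} (true  ∷ S) a    b       n≡ = ∑⊇-size S a b (suc-injective n≡)
∑⊇-size {suc n} (false ∷ S) zero b       n≡ =
  contradiction (≤-trans (≤-reflexive (trans n≡ (+-identityʳ _))) (∣p∣≤n S)) 1+n≰n
∑⊇-size {suc n} (false ∷ S) (suc a) zero n≡ = cong₂ _+_
  (∑⊇-vanishing _ S (λ e ∣S∣≤∣e∣ → ¬T⇒⟦⟧≡0 (λ eq → <⇒≱ (s≤s ∣S∣≤∣e∣) (≤-reflexive (trans (≡ᵇ⇒≡ _ _ eq) (+-identityʳ _))))))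
  (∑⊇-size S a 0 (suc-injective (trans n≡ (+-suc _ a))))
∑⊇-size {suc n} (false ∷ S) (suc a) (suc b) n≡ = trans (cong₂ _+_
  (trans (∑⊇-cong (λ e → cong (λ t → ⟦ suc ∣ e ∣ ≡ᵇ t ⟧) (+-suc ∣ S ∣ b)) S)
         (∑⊇-size S a b (suc-injective (trans n≡ (+-suc _ a)))))
  (∑⊇-size S a (suc b) (suc-injective (trans n≡ (+-suc _ a)))))
  (nCk+nC[k+1]≡[n+1]C[k+1] a b)

#⊇ : ∀ {n} → (Subset n → Bool) → Subset n → ℕ
#⊇ p = ∑⊇ (⟦_⟧ ∘ p)

#⊇-maximal : ∀ {n} (p : Subset n → Bool) S → (∀ e → T (p e) → ∣ e ∣ ≡ ∣ S ∣) → #⊇ p S ≡ ⟦ p S ⟧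
#⊇-maximal p S sized = ∑⊇-maximal (⟦_⟧ ∘ p) S (λ e ∣S∣<∣e∣ → ¬T⇒⟦⟧≡0 (<⇒≢ ∣S∣<∣e∣ ∘ sym ∘ sized e))

∑-outside : ∀ {n} → Subset n → (Fin n → ℕ) → ℕ
∑-outside {n} S g = ∑[ v < n ] (if lookup S v then 0 else g v)

∑-outside-distrib-+ : ∀ {n} (S : Subset n) (g h : Fin n → ℕ) →
                      ∑-outside S (λ v → g v + h v) ≡ ∑-outside S g + ∑-outside S h
∑-outside-distrib-+ S g h =
  trans (sum-cong-≗ (λ v → if-distrib (lookup S v))) (∑-distrib-+ (λ v → if lookup S v then 0 else g v) _)
  where
  if-distrib : ∀ {x y} b → (if b then 0 else x + y) ≡ (if b then 0 else x) + (if b then 0 else y)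
  if-distrib true  = refl
  if-distrib false = refl

∑-outside-*ʳ : ∀ {n} (S : Subset n) (g : Fin n → ℕ) z →
               ∑-outside S (λ v → g v * z) ≡ ∑-outside S g * z
∑-outside-*ʳ S g z =
  trans (sum-cong-≗ (λ v → if-*ʳ (lookup S v))) (sym (*-distribʳ-sum z (λ v → if lookup S v then 0 else g v)))
  where
  if-*ʳ : ∀ {y} b → (if b then 0 else y * z) ≡ (if b then 0 else y) * z
  if-*ʳ true  = refl
  if-*ʳ false = refl

-- Both sides count the pairs (v, e) with S ⊆ e and v ∈ e, weighted by f e.
∑⊇-extensions : ∀ {n} (f : Subset n → ℕ) S →
  ∑-outside S (λ v → ∑⊇ f (⁅ v ⁆ ∪ S)) + ∣ S ∣ * ∑⊇ f S ≡ ∑⊇ (λ e → ∣ e ∣ * f e) S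
∑⊇-extensions {zero}  f []          = refl
∑⊇-extensions {suc n} f (true  ∷ S) = begin
  O₁ + (c₁ + ∣ S ∣ * c₁)                  ≡⟨ x∙yz≈y∙xz O₁ c₁ _ ⟩
  c₁ + (O₁ + ∣ S ∣ * c₁)                  ≡⟨ cong (c₁ +_) (∑⊇-extensions f₁ S) ⟩
  c₁ + ∑⊇ (λ e → ∣ e ∣ * f₁ e) S          ≡⟨ ∑⊇-distrib-+ f₁ (λ e → ∣ e ∣ * f₁ e) S ⟨
  ∑⊇ (λ e → suc ∣ e ∣ * f₁ e) S           ∎
  where
  open ≡-Reasoning
  f₁ : Subset n → ℕ
  f₁ = f ∘ (true ∷_)
  c₁ O₁ : ℕ
  c₁ = ∑⊇ f₁ S
  O₁ = ∑-outside S (λ v → ∑⊇ f₁ (⁅ v ⁆ ∪ S))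
∑⊇-extensions {suc n} f (false ∷ S) = begin
  ∑⊇ f₁ (⊥ ∪ S) + ∑-outside S (λ v → ∑⊇ f₁ (⁅ v ⁆ ∪ S) + ∑⊇ f₀ (⁅ v ⁆ ∪ S)) + ∣ S ∣ * (c₁ + c₀)
    ≡⟨ cong₂ (λ x y → x + y + ∣ S ∣ * (c₁ + c₀)) (cong (∑⊇ f₁) (∪-identityˡ S)) (∑-outside-distrib-+ S _ _) ⟩
  c₁ + (O₁ + O₀) + ∣ S ∣ * (c₁ + c₀)
    ≡⟨ rearrange c₁ c₀ O₁ O₀ ∣ S ∣ ⟩
  (c₁ + (O₁ + ∣ S ∣ * c₁)) + (O₀ + ∣ S ∣ * c₀)
    ≡⟨ cong₂ (λ x y → (c₁ + x) + y) (∑⊇-extensions f₁ S) (∑⊇-extensions f₀ S) ⟩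
  (c₁ + ∑⊇ (λ e → ∣ e ∣ * f₁ e) S) + ∑⊇ (λ e → ∣ e ∣ * f₀ e) S
    ≡⟨ cong (_+ ∑⊇ (λ e → ∣ e ∣ * f₀ e) S) (∑⊇-distrib-+ f₁ (λ e → ∣ e ∣ * f₁ e) S) ⟨
  ∑⊇ (λ e → suc ∣ e ∣ * f₁ e) S + ∑⊇ (λ e → ∣ e ∣ * f₀ e) S
    ∎
  where
  open ≡-Reasoning
  f₁ f₀ : Subset n → ℕ
  f₁ = f ∘ (true ∷_)
  f₀ = f ∘ (false ∷_)
  c₁ c₀ O₁ O₀ : ℕ
  c₁ = ∑⊇ f₁ S
  c₀ = ∑⊇ f₀ S
  O₁ = ∑-outside S (λ v → ∑⊇ f₁ (⁅ v ⁆ ∪ S))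
  O₀ = ∑-outside S (λ v → ∑⊇ f₀ (⁅ v ⁆ ∪ S))
  rearrange : ∀ c₁ c₀ O₁ O₀ s → c₁ + (O₁ + O₀) + s * (c₁ + c₀) ≡ (c₁ + (O₁ + s * c₁)) + (O₀ + s * c₀)
  rearrange = solve-∀

#⊇-extensions : ∀ {n k} (p : Subset n → Bool) S → (∀ e → T (p e) → ∣ e ∣ ≡ k) →
  ∑-outside S (λ v → #⊇ p (⁅ v ⁆ ∪ S)) + ∣ S ∣ * #⊇ p S ≡ k * #⊇ p S
#⊇-extensions {k = k} p S uniform = begin
  ∑-outside S (λ v → #⊇ p (⁅ v ⁆ ∪ S)) + ∣ S ∣ * #⊇ p S ≡⟨ ∑⊇-extensions (⟦_⟧ ∘ p) S ⟩
  ∑⊇ (λ e → ∣ e ∣ * ⟦ p e ⟧) S                        ≡⟨ ∑⊇-cong size≡k S ⟩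
  ∑⊇ (λ e → k * ⟦ p e ⟧) S                            ≡⟨ ∑⊇-*ˡ k (⟦_⟧ ∘ p) S ⟩
  k * #⊇ p S                                          ∎
  where
  open ≡-Reasoning
  size≡k : ∀ e → ∣ e ∣ * ⟦ p e ⟧ ≡ k * ⟦ p e ⟧
  size≡k e with p e in pe
  ... | true  = cong (_* 1) (uniform e (subst T (sym pe) _))
  ... | false = trans (*-zeroʳ ∣ e ∣) (sym (*-zeroʳ k))

length-filterᵇ : ∀ {A : Set} (q : A → Bool) xs →
                 length (filterᵇ q xs) ≡ sumᴸ (List.map (⟦_⟧ ∘ q) xs)
length-filterᵇ q []       = refl
length-filterᵇ q (x ∷ xs) with q x
... | true  = cong suc (length-filterᵇ q xs)
... | false = length-filterᵇ q xs

∑-allSubsets : ∀ {n} (f : Subset n → ℕ) S →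
  sumᴸ (List.map (λ e → if does (S ⊆? e) then f e else 0) (allSubsets n)) ≡ ∑⊇ f S
∑-allSubsets {zero}  f []      = +-identityʳ (f [])
∑-allSubsets {suc n} f (x ∷ S) = begin
  sumᴸ (List.map (h x) (List.map (true ∷_) A ++ List.map (false ∷_) A))
    ≡⟨ cong sumᴸ (map-++ (h x) (List.map (true ∷_) A) _) ⟩
  sumᴸ (List.map (h x) (List.map (true ∷_) A) ++ List.map (h x) (List.map (false ∷_) A))
    ≡⟨ sum-++ (List.map (h x) (List.map (true ∷_) A)) _ ⟩
  sumᴸ (List.map (h x) (List.map (true ∷_) A)) + sumᴸ (List.map (h x) (List.map (false ∷_) A))
    ≡⟨ cong₂ _+_ (cong sumᴸ (map-∘ A)) (cong sumᴸ (map-∘ A)) ⟨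
  sumᴸ (List.map (h x ∘ (true ∷_)) A) + sumᴸ (List.map (h x ∘ (false ∷_)) A)
    ≡⟨ split x ⟩
  ∑⊇ f (x ∷ S)
    ∎
  where
  open ≡-Reasoning
  A : List (Subset n)
  A = allSubsets n
  h : Bool → Subset (suc n) → ℕ
  h x e = if does ((x ∷ S) ⊆? e) then f e else 0
  sum-zeros : ∀ (xs : List (Subset n)) → sumᴸ (List.map (λ _ → 0) xs) ≡ 0
  sum-zeros []       = refl
  sum-zeros (_ ∷ xs) = sum-zeros xs
  split : ∀ x → sumᴸ (List.map (h x ∘ (true ∷_)) A) + sumᴸ (List.map (h x ∘ (false ∷_)) A) ≡ ∑⊇ f (x ∷ S)
  split true  = trans (cong₂ _+_ (∑-allSubsets (f ∘ (true ∷_)) S) (sum-zeros A)) (+-identityʳ _)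
  split false = cong₂ _+_ (∑-allSubsets (f ∘ (true ∷_)) S) (∑-allSubsets (f ∘ (false ∷_)) S)

deg≡#⊇ : ∀ {k n} (H : KGraph k n) S → deg H S ≡ #⊇ (isEdge H) S
deg≡#⊇ {n = n} H S = begin
  length (filterᵇ (λ e → isEdge H e ∧ does (S ⊆? e)) (allSubsets n))
    ≡⟨ length-filterᵇ (λ e → isEdge H e ∧ does (S ⊆? e)) (allSubsets n) ⟩
  sumᴸ (List.map (λ e → ⟦ isEdge H e ∧ does (S ⊆? e) ⟧) (allSubsets n))
    ≡⟨ cong sumᴸ (map-cong (λ e → ⟦∧⟧ (isEdge H e) (does (S ⊆? e))) (allSubsets n)) ⟩
  sumᴸ (List.map (λ e → if does (S ⊆? e) then ⟦ isEdge H e ⟧ else 0) (allSubsets n))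
    ≡⟨ ∑-allSubsets (⟦_⟧ ∘ isEdge H) S ⟩
  #⊇ (isEdge H) S
    ∎
  where
  open ≡-Reasoning
  ⟦∧⟧ : ∀ a b → ⟦ a ∧ b ⟧ ≡ (if b then ⟦ a ⟧ else 0)
  ⟦∧⟧ true  true  = refl
  ⟦∧⟧ true  false = refl
  ⟦∧⟧ false true  = refl
  ⟦∧⟧ false false = refl

-- D ≥ (1 - 1/X) N.
NearlyAll : ℕ → ℕ → ℕ → Set
NearlyAll X N D = (X ∸ 1) * N ≤ D * X

NearlyAll⇔complement≤ : ∀ {D c N} X → D + c ≡ N → NearlyAll X N D ⇔ c * X ≤ N
NearlyAll⇔complement≤ {c = c} {N} zero _ = mk⇔ (λ _ → subst (_≤ N) (sym (*-zeroʳ c)) z≤n) (λ _ → z≤n)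
NearlyAll⇔complement≤ {D} {c} (suc Y) refl = mk⇔
  (λ nearly → begin
    c * suc Y ≡⟨ e₃ c Y ⟩
    c * Y + c ≤⟨ +-monoˡ-≤ c (+-cancelˡ-≤ (D * Y) _ _ (subst₂ _≤_ (e₁ Y D c) (e₂ D Y) nearly)) ⟩
    D + c     ∎)
  (λ few → begin
    Y * (D + c)   ≡⟨ e₁ Y D c ⟩
    D * Y + c * Y ≤⟨ +-monoʳ-≤ (D * Y) (+-cancelʳ-≤ c _ _ (subst (_≤ D + c) (e₃ c Y) few)) ⟩
    D * Y + D     ≡⟨ e₂ D Y ⟨
    D * suc Y     ∎)
  where
  open ≤-Reasoning
  e₁ : ∀ Y D c → Y * (D + c) ≡ D * Y + c * Y
  e₁ = solve-∀
  e₂ : ∀ D Y → D * suc Y ≡ D * Y + D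
  e₂ = solve-∀
  e₃ : ∀ c Y → c * suc Y ≡ c * Y + c
  e₃ = solve-∀

NearlyAll-*-scale : ∀ {c N D} Y → 1 ≤ c → NearlyAll (c * Y) N D → NearlyAll Y N D
NearlyAll-*-scale {c} {N} {D} Y 1≤c nearly = *-cancelʳ-≤ ((Y ∸ 1) * N) (D * Y) c {{>-nonZero 1≤c}} (begin
  (Y ∸ 1) * N * c   ≡⟨ *-comm ((Y ∸ 1) * N) c ⟩
  c * ((Y ∸ 1) * N) ≡⟨ *-assoc c (Y ∸ 1) N ⟨
  c * (Y ∸ 1) * N   ≡⟨ cong (_* N) (*-distribˡ-∸ c Y 1) ⟩
  (c * Y ∸ c * 1) * N ≤⟨ *-monoˡ-≤ N (∸-monoʳ-≤ (c * Y) (≤-trans 1≤c (≤-reflexive (sym (*-identityʳ c))))) ⟩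
  (c * Y ∸ 1) * N   ≤⟨ nearly ⟩
  D * (c * Y)       ≡⟨ cong (D *_) (*-comm c Y) ⟩
  D * (Y * c)       ≡⟨ *-assoc D Y c ⟨
  D * Y * c         ∎)
  where open ≤-Reasoning

take-take-≤ : ∀ {A : Set} {i j} (l : List A) → i ≤ j → take i (take j l) ≡ take i l
take-take-≤ {i = i} {j} l i≤j = trans (take-take i j l) (cong (λ t → take t l) (m≤n⇒m⊓n≡m i≤j))

take-++ˡ : ∀ {A : Set} {j} (xs ys : List A) → j ≤ length xs → take j (xs ++ ys) ≡ take j xs
take-++ˡ {j = zero}  xs       ys _         = refl
take-++ˡ {j = suc j} (x ∷ xs) ys (s≤s j≤) = cong (x ∷_) (take-++ˡ xs ys j≤)

take-reverse-∷ : ∀ {A : Set} {j} (x : A) xs → j ≤ length xs → take j (reverse (x ∷ xs)) ≡ take j (reverse xs)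
take-reverse-∷ {j = j} x xs j≤ = trans (cong (take j) (unfold-reverse x xs))
  (take-++ˡ (reverse xs) (x ∷ []) (subst (j ≤_) (sym (length-reverse xs)) j≤))

∉toSet⇒All≢ : ∀ {n} {v : Fin n} l → v ∉ toSet l → All (v ≢_) l
∉toSet⇒All≢ []      _  = []
∉toSet⇒All≢ (x ∷ l) v∉ =
  (λ { refl → v∉ (x∈p∪q⁺ (inj₁ (x∈⁅x⁆ x))) }) ∷ ∉toSet⇒All≢ l (v∉ ∘ x∈p∪q⁺ ∘ inj₂)

All≢⇒∉toSet : ∀ {n} {v : Fin n} {l} → All (v ≢_) l → v ∉ toSet l
All≢⇒∉toSet []                        = ∉⊥
All≢⇒∉toSet {l = x ∷ l} (v≢x ∷ v∉l) v∈ with x∈p∪q⁻ ⁅ x ⁆ (toSet l) v∈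
... | inj₁ v∈⁅x⁆ = v≢x (x∈⁅y⁆⇒x≡y x v∈⁅x⁆)
... | inj₂ v∈l   = All≢⇒∉toSet v∉l v∈l

∉toSet-take : ∀ {n} {v : Fin n} {l} j → v ∉ toSet l → v ∉ toSet (take j l)
∉toSet-take {l = l} j v∉ = All≢⇒∉toSet (All.take⁺ j (∉toSet⇒All≢ l v∉))

∣⁅x⁆∪p∣ : ∀ {n} (x : Fin n) p → x ∉ p → ∣ ⁅ x ⁆ ∪ p ∣ ≡ suc ∣ p ∣
∣⁅x⁆∪p∣ zero    (true  ∷ p) x∉ = contradiction here x∉
∣⁅x⁆∪p∣ zero    (false ∷ p) _  = cong (suc ∘ ∣_∣) (∪-identityˡ p)
∣⁅x⁆∪p∣ (suc x) (true  ∷ p) x∉ = cong suc (∣⁅x⁆∪p∣ x p (x∉ ∘ there))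
∣⁅x⁆∪p∣ (suc x) (false ∷ p) x∉ = ∣⁅x⁆∪p∣ x p (x∉ ∘ there)

∣toSet∣≡length : ∀ {n} {l : List (Fin n)} → Unique l → ∣ toSet l ∣ ≡ length l
∣toSet∣≡length {n} []        = ∣⊥∣≡0 n
∣toSet∣≡length (x∉l ∷ uniq) =
  trans (∣⁅x⁆∪p∣ _ _ (All≢⇒∉toSet x∉l)) (cong suc (∣toSet∣≡length uniq))

∣∁⁅x⁆∪p∪q∣ : ∀ {n} (x : Fin n) p q → x ∉ p ∪ q → suc ∣ ∁ ((⁅ x ⁆ ∪ p) ∪ q) ∣ ≡ ∣ ∁ (p ∪ q) ∣
∣∁⁅x⁆∪p∪q∣ zero    (true  ∷ p) (t ∷ q)     x∉ = contradiction here x∉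
∣∁⁅x⁆∪p∪q∣ zero    (false ∷ p) (true ∷ q)  x∉ = contradiction here x∉
∣∁⁅x⁆∪p∪q∣ zero    (false ∷ p) (false ∷ q) _  = cong (λ r → suc ∣ ∁ (r ∪ q) ∣) (∪-identityˡ p)
∣∁⁅x⁆∪p∪q∣ (suc x) (s ∷ p)     (t ∷ q)     x∉ with s ∨ t
... | true  = ∣∁⁅x⁆∪p∪q∣ x p q (x∉ ∘ there)
... | false = cong suc (∣∁⁅x⁆∪p∪q∣ x p q (x∉ ∘ there))

-- Degrees, missing edges and density

module _ {k n : ℕ} (H : KGraph k n) where

  nonEdge : Subset n → Bool
  nonEdge e = not (isEdge H e) ∧ (∣ e ∣ ≡ᵇ k)

  missing : Subset n → ℕ
  missing = #⊇ nonEdge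

  nonEdge-uniform : ∀ e → T (nonEdge e) → ∣ e ∣ ≡ k
  nonEdge-uniform e ne = ≡ᵇ⇒≡ _ _ (proj₂ (Equivalence.to T-∧ ne))

  deg+missing : ∀ S a b → n ≡ ∣ S ∣ + a → k ≡ ∣ S ∣ + b → deg H S + missing S ≡ a C b
  deg+missing S a b n≡ k≡ = begin
    deg H S + missing S                         ≡⟨ cong (_+ missing S) (deg≡#⊇ H S) ⟩
    #⊇ (isEdge H) S + missing S                 ≡⟨ ∑⊇-distrib-+ (⟦_⟧ ∘ isEdge H) (⟦_⟧ ∘ nonEdge) S ⟨
    ∑⊇ (λ e → ⟦ isEdge H e ⟧ + ⟦ nonEdge e ⟧) S ≡⟨ ∑⊇-cong edge-or-nonEdge S ⟩
    ∑⊇ (λ e → ⟦ ∣ e ∣ ≡ᵇ ∣ S ∣ + b ⟧) S         ≡⟨ ∑⊇-size S a b n≡ ⟩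
    a C b                                       ∎
    where
    open ≡-Reasoning
    edge-or-nonEdge : ∀ e → ⟦ isEdge H e ⟧ + ⟦ nonEdge e ⟧ ≡ ⟦ ∣ e ∣ ≡ᵇ ∣ S ∣ + b ⟧
    edge-or-nonEdge e with isEdge H e in edge
    ... | true  = cong ⟦_⟧ (sym (Equivalence.to T-≡ (≡⇒≡ᵇ _ _ (trans (uniform H e (subst T (sym edge) _)) k≡))))
    ... | false = cong (λ t → ⟦ ∣ e ∣ ≡ᵇ t ⟧) k≡

  missing≡0⇒edge : ∀ e → ∣ e ∣ ≡ k → missing e ≡ 0 → T (isEdge H e)
  missing≡0⇒edge e ∣e∣≡k none = decidable-stable (T? (isEdge H e)) λ ¬edge →
    ⟦⟧≡0⇒¬T (trans (sym (#⊇-maximal nonEdge e (λ e′ ne → trans (nonEdge-uniform e′ ne) (sym ∣e∣≡k)))) none)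
            (Equivalence.from T-∧ (Equivalence.from T-not-≡ (¬-not (¬edge ∘ Equivalence.from T-≡)) , ≡⇒≡ᵇ _ _ ∣e∣≡k))

-- Good and GoodPath of the statement are GoodAt (M k) and GoodPathAt (M k); X plays the role of 1/ρ.
module _ {k n : ℕ} (X : ℕ) (H : KGraph k n) where

  Dense : Subset n → ℕ → Set
  Dense S i = NearlyAll (X ^ (k ∸ i)) ((n ∸ i) C (k ∸ i)) (deg H S)

  GoodAt : List (Fin n) → Set
  GoodAt xs = length xs ≡ k ∸ 1 × Unique xs × ((i : ℕ) → 1 ≤ i → i ≤ k ∸ 1 → Dense (toSet (take i xs)) i)

  GoodPathAt : List (Fin n) → Set
  GoodPathAt w = IsPath H w × GoodAt (take (k ∸ 1) w) × GoodAt (take (k ∸ 1) (reverse w))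

  Dense⇔few-missing : ∀ {S i} → ∣ S ∣ ≡ i → i ≤ k → k ≤ n →
                      Dense S i ⇔ missing H S * X ^ (k ∸ i) ≤ (n ∸ i) C (k ∸ i)
  Dense⇔few-missing {S} refl i≤k k≤n = NearlyAll⇔complement≤ {deg H S} {missing H S} (X ^ (k ∸ ∣ S ∣))
    (deg+missing H S _ _ (sym (m+[n∸m]≡n (≤-trans i≤k k≤n))) (sym (m+[n∸m]≡n i≤k)))

  badExtension : Subset n → ℕ → Fin n → Bool
  badExtension S j v =
    not (lookup S v) ∧ ((n ∸ suc j) C (k ∸ suc j) ≤ᵇ missing H (⁅ v ⁆ ∪ S) * X ^ (k ∸ suc j))

  -- Σ_{v ∉ S} missing(⁅ v ⁆ ∪ S) = (k - j) missing(S) ≤ (k - j) C(n-j, k-j) / X^(k-j), each bad v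
  -- contributes at least C(n-j-1, k-j-1) / X^(k-j-1), and absorption leaves at most (n - j) / X of them.
  count-badExtension : ∀ {S j} → ∣ S ∣ ≡ j → j < k → k ≤ n →
                       missing H S * X ^ (k ∸ j) ≤ (n ∸ j) C (k ∸ j) → count (badExtension S j) * X ≤ n
  count-badExtension {S} {j} ∣S∣≡j j<k k≤n few = ≤-trans
    (*-cancelʳ-≤ (count bad * X) (suc a) (a C d) {{>-nonZero (C-pos (∸-monoˡ-≤ (suc j) k≤n))}} (begin
      count bad * X * (a C d)                                ≡⟨ xy*z≡xz*y (count bad) X (a C d) ⟩
      count bad * (a C d) * X                                ≡⟨ cong (_* X) (*-distribʳ-sum (a C d) (⟦_⟧ ∘ bad)) ⟩
      ∑[ v < n ] (⟦ bad v ⟧ * (a C d)) * X                  ≤⟨ *-monoˡ-≤ X (∑-mono-≤ (λ v → ⟦not∧≤ᵇ⟧*≤ (lookup S v) _ _)) ⟩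
      ∑-outside S (λ v → missing H (⁅ v ⁆ ∪ S) * X ^ d) * X ≡⟨ cong (_* X) (∑-outside-*ʳ S (λ v → missing H (⁅ v ⁆ ∪ S)) (X ^ d)) ⟩
      ∑-outside S (λ v → missing H (⁅ v ⁆ ∪ S)) * X ^ d * X ≡⟨ cong (λ t → t * X ^ d * X) extensions ⟩
      suc d * c * X ^ d * X                                  ≡⟨ regroup (suc d) c (X ^ d) X ⟩
      suc d * (c * (X * X ^ d))                              ≤⟨ *-monoʳ-≤ (suc d) few′ ⟩
      suc d * (suc a C suc d)                                ≡⟨ C-absorb a d ⟩
      suc a * (a C d)                                        ∎))
    (≤-trans (≤-reflexive (sym n∸j≡1+a)) (m∸n≤m n j))
    where
    open ≤-Reasoning
    a d c : ℕ
    a = n ∸ suc j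
    d = k ∸ suc j
    c = missing H S
    bad : Fin n → Bool
    bad = badExtension S j
    n∸j≡1+a : n ∸ j ≡ suc a
    n∸j≡1+a = +-∸-assoc 1 (<-≤-trans j<k k≤n)
    few′ : c * (X * X ^ d) ≤ suc a C suc d
    few′ = subst₂ (λ x y → c * X ^ x ≤ y C x) (+-∸-assoc 1 j<k) n∸j≡1+a few
    extensions : ∑-outside S (λ v → missing H (⁅ v ⁆ ∪ S)) ≡ suc d * c
    extensions = +-cancelʳ-≡ (j * c) _ _ (begin-equality
      ∑-outside S (λ v → missing H (⁅ v ⁆ ∪ S)) + j * c     ≡⟨ cong (λ t → _ + t * c) ∣S∣≡j ⟨
      ∑-outside S (λ v → missing H (⁅ v ⁆ ∪ S)) + ∣ S ∣ * c ≡⟨ #⊇-extensions (nonEdge H) S (nonEdge-uniform H) ⟩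
      k * c                 ≡⟨ cong (_* c) (m+[n∸m]≡n (<⇒≤ j<k)) ⟨
      (j + (k ∸ j)) * c     ≡⟨ cong (λ t → (j + t) * c) (+-∸-assoc 1 j<k) ⟩
      (j + suc d) * c       ≡⟨ *-distribʳ-+ c j (suc d) ⟩
      j * c + suc d * c     ≡⟨ +-comm (j * c) _ ⟩
      suc d * c + j * c     ∎)
    regroup : ∀ x y z w → x * y * z * w ≡ x * (y * (w * z))
    regroup = solve-∀


  ¬badExtension⇒sparse : ∀ {S j v} → v ∉ S → badExtension S j v ≡ false →
    missing H (⁅ v ⁆ ∪ S) * X ^ (k ∸ suc j) < (n ∸ suc j) C (k ∸ suc j)
  ¬badExtension⇒sparse {S} {j} {v} v∉S ¬bad =
    ≰⇒> λ dense → subst T (threshold-false (¬-not (v∉S ∘ lookup⇒[]= v S)) ¬bad) (≤⇒≤ᵇ dense)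
    where
    threshold-false : ∀ {b t} → b ≡ false → (not b ∧ t) ≡ false → t ≡ false
    threshold-false refl t≡false = t≡false

-- Extending a good path

module Extension {m n : ℕ} (X : ℕ) (H : KGraph (2 + m) n) (k≤n : 2 + m ≤ n)
                 (vertex-dense : ∀ v → Dense X H ⁅ v ⁆ 1) (F : Subset n) where

  k : ℕ
  k = 2 + m

  Uncovered : List (Fin n) → Subset n
  Uncovered w = ∁ (toSet w ∪ F)

  prefix : List (Fin n) → ℕ → Subset n
  prefix w j = toSet (take j w)

  module _ {w : List (Fin n)} (path : GoodPathAt X H w) where

    private
      uniq : Unique w
      uniq = proj₁ (proj₁ path)

      k≤length : k ≤ length w
      k≤length = proj₁ (proj₂ (proj₁ path))

      edges : (j : ℕ) → j + k ≤ length w → T (isEdge H (toSet (take k (drop j w))))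
      edges = proj₂ (proj₂ (proj₁ path))

      front : GoodAt X H (take (suc m) w)
      front = proj₁ (proj₂ path)

      back : GoodAt X H (take (suc m) (reverse w))
      back = proj₂ (proj₂ path)

      1+m≤length : suc m ≤ length w
      1+m≤length = ≤-trans (n≤1+n _) k≤length

    ∣prefix∣ : ∀ {j} → j ≤ suc m → ∣ prefix w j ∣ ≡ j
    ∣prefix∣ {j} j≤ = trans (∣toSet∣≡length (Unique.take⁺ j uniq))
                            (trans (length-take j w) (m≤n⇒m⊓n≡m (≤-trans j≤ 1+m≤length)))

    prefix-sparse : ∀ j → 1 ≤ j → j ≤ suc m → missing H (prefix w j) * X ^ (k ∸ j) ≤ (n ∸ j) C (k ∸ j)
    prefix-sparse j 1≤j j≤ = Equivalence.to (Dense⇔few-missing X H (∣prefix∣ j≤) (m≤n⇒m≤1+n j≤) k≤n)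
      (subst (λ l → Dense X H (toSet l) j) (take-take-≤ w j≤) (proj₂ (proj₂ front) j 1≤j j≤))

    good-vertex : k * n < ∣ Uncovered w ∣ * X →
                  ∃ λ v → v ∈ Uncovered w × (∀ j → 1 ≤ j → j ≤ suc m → badExtension X H (prefix w j) j v ≡ false)
    good-vertex gap =
      let v , v∈U , avoids = sieve X n (suc m) (lookup (Uncovered w)) (λ j → badExtension X H (prefix w j) j)
                               (λ j 1≤j j≤ → count-badExtension X H (∣prefix∣ j≤) (s≤s j≤) k≤n (prefix-sparse j 1≤j j≤))
                               (≤-<-trans (*-monoˡ-≤ n (n≤1+n (suc m))) (subst (λ c → k * n < c * X) (∣p∣≡count (Uncovered w)) gap))
      in v , lookup⇒[]= v (Uncovered w) (Equivalence.to T-≡ v∈U) , avoids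

    extend-by : ∀ v → v ∉ toSet w →
                (∀ j → 1 ≤ j → j ≤ suc m → missing H (⁅ v ⁆ ∪ prefix w j) * X ^ (k ∸ suc j) < (n ∸ suc j) C (k ∸ suc j)) →
                GoodPathAt X H (v ∷ w)
    extend-by v v∉w sparse = ((v∉w′ ∷ uniq) , m≤n⇒m≤1+n k≤length , edges′) , front′ , back′
      where
      v∉w′ : All (v ≢_) w
      v∉w′ = ∉toSet⇒All≢ w v∉w

      ∣⁅v⁆∪prefix∣ : ∀ {j} → j ≤ suc m → ∣ ⁅ v ⁆ ∪ prefix w j ∣ ≡ suc j
      ∣⁅v⁆∪prefix∣ {j} j≤ = trans (∣⁅x⁆∪p∣ v _ (∉toSet-take j v∉w)) (cong suc (∣prefix∣ j≤))

      -- At level k the bound reads missing * X ^ 0 < (n ∸ k) C 0 = 1.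
      edge : T (isEdge H (⁅ v ⁆ ∪ prefix w (suc m)))
      edge = missing≡0⇒edge H _ (∣⁅v⁆∪prefix∣ ≤-refl) (trans (sym (*-identityʳ _)) (n<1⇒n≡0
        (subst (λ t → missing H (⁅ v ⁆ ∪ prefix w (suc m)) * X ^ t < (n ∸ k) C t) (n∸n≡0 k) (sparse (suc m) (s≤s z≤n) ≤-refl))))

      edges′ : (j : ℕ) → j + k ≤ length (v ∷ w) → T (isEdge H (toSet (take k (drop j (v ∷ w)))))
      edges′ zero    _ = edge
      edges′ (suc j) h = edges j (s≤s⁻¹ h)

      dense′ : (i : ℕ) → 1 ≤ i → i ≤ suc m → Dense X H (toSet (take i (v ∷ take m w))) i
      dense′ (suc zero)    _ _         = subst (λ S → Dense X H S 1) (sym (∪-identityʳ ⁅ v ⁆)) (vertex-dense v)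
      dense′ (suc (suc i)) _ (s≤s i<m) =
        subst (λ l → Dense X H (⁅ v ⁆ ∪ toSet l) (2 + i)) (sym (take-take-≤ w i<m))
          (Equivalence.from (Dense⇔few-missing X H (∣⁅v⁆∪prefix∣ (m≤n⇒m≤1+n i<m)) (s≤s (s≤s (<⇒≤ i<m))) k≤n)
            (<⇒≤ (sparse (suc i) (s≤s z≤n) (m≤n⇒m≤1+n i<m))))

      front′ : GoodAt X H (v ∷ take m w)
      front′ = cong suc (trans (length-take m w) (m≤n⇒m⊓n≡m (≤-trans (n≤1+n m) 1+m≤length)))
             , Unique.take⁺ (suc m) (v∉w′ ∷ uniq) , dense′

      back′ : GoodAt X H (take (suc m) (reverse (v ∷ w)))
      back′ = subst (GoodAt X H) (sym (take-reverse-∷ v w 1+m≤length)) back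

    extend : k * n < ∣ Uncovered w ∣ * X → ∃ λ v → v ∈ Uncovered w × GoodPathAt X H (v ∷ w)
    extend gap =
      let v , v∈U , avoids = good-vertex gap
          v∉w = x∈∁p⇒x∉p v∈U ∘ x∈p∪q⁺ ∘ inj₁
      in v , v∈U , extend-by v v∉w (λ j 1≤j j≤ → ¬badExtension⇒sparse X H {j = j} (∉toSet-take j v∉w) (avoids j 1≤j j≤))

  extend-repeatedly : ∀ f w → ∣ Uncovered w ∣ ≤ f → GoodPathAt X H w →
    Σ (List (Fin n)) λ P′ → GoodPathAt X H P′ × (∃ λ a → P′ ≡ a ++ w) × ∣ Uncovered P′ ∣ * X ≤ k * n
  extend-repeatedly zero w ∣U∣≤0 path =
    w , path , ([] , refl) , subst (λ u → u * X ≤ k * n) (sym (n≤0⇒n≡0 ∣U∣≤0)) z≤n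
  extend-repeatedly (suc f) w ∣U∣≤1+f path with ∣ Uncovered w ∣ * X ≤? k * n
  ... | yes covered = w , path , ([] , refl) , covered
  ... | no ¬covered =
    let v , v∈U , path′ = extend path (≰⇒> ¬covered)
        P′ , good , (a , P′≡a++v∷w) , covered = extend-repeatedly f (v ∷ w)
          (s≤s⁻¹ (subst (_≤ suc f) (sym (∣∁⁅x⁆∪p∪q∣ v (toSet w) F (x∈∁p⇒x∉p v∈U))) ∣U∣≤1+f)) path′
    in P′ , good , (a ++ v ∷ [] , trans P′≡a++v∷w (sym (++-assoc a (v ∷ []) w))) , covered

lemma5 : (k : ℕ) → 2 ≤ k →
    Σ ℕ λ n₀ → (n : ℕ) → n ≥ n₀ → (H : KGraph k n) →
    ((v : Fin n) → deg H ⁅ v ⁆ * (22 * M k ^ (k ∸ 1))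
                     ≥ (22 * M k ^ (k ∸ 1) ∸ 1) * ((n ∸ 1) C (k ∸ 1))) →
    (P : List (Fin n)) → GoodPath H P →
    (F : Subset n) → ∣ F ∣ * M k ≤ k * n →
    Σ (List (Fin n)) λ P' → GoodPath H P' × ContainsPath P' P ×
      ∣ ∁ (toSet P' ∪ F) ∣ * M k ≤ k * n
lemma5 zero          ()
lemma5 (suc zero)    (s≤s ())
lemma5 k@(suc (suc m)) _ = k , λ n k≤n H min-degree P path F _ →
  let vertex-dense v = NearlyAll-*-scale {22} {D = deg H ⁅ v ⁆} (M k ^ (k ∸ 1)) (s≤s z≤n) (min-degree v)
      P′ , good , (a , P′≡a++P) , covered =
        Extension.extend-repeatedly (M k) H k≤n vertex-dense F n P (∣p∣≤n (∁ (toSet P ∪ F))) path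
  in P′ , good , inj₁ (a , [] , trans P′≡a++P (cong (a ++_) (sym (++-identityʳ P)))) , covered
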